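{- Let $k\ge4$, $V=[k]\times[k]$, and let $f:2^V\to\mathbb{R}_{\ge0}$ be given by $f(S)=\sum_{i=1}^k\big(g(R_i\cap S)+g(C_i\cap S)\big)$, where $R_i=\{(i,j):j\in[k]\}$, $C_i=\{(j,i):j\in[k]\}$, $g(S)=\phi_t(|S|)$ if $S$ contains some $(\ell,\ell)$ and $g(S)=\phi_n(|S|)$ otherwise, with $\phi_n(a)=\min\{a,\frac78k\}$ and $\phi_t(a)=\min\{\frac38ka,\frac38k+a-1,\frac78k\}$. Let $Q_1,\dots,Q_k$ be a symmetric multiway partition of $V$ for which there exists $i^*\in[k]$ such that $\overrightarrow{R}_i\subseteq Q_i$ for all $i\in[i^*]$ and $\overrightarrow{R}_i\subseteq Q_1$ for all $i\in[k]\setminus[i^*]$. Then $\sum_{\ell=1}^k f(Q_\ell)\ge\frac{10k^2-6k-1}{4}$.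
   Context: $\overrightarrow{R}_i=\{(i,j): j\in\{i+1,\dots,k\}\}$. For $A\subseteq V$, $A^T=\{(j,i):(i,j)\in A\}$. A symmetric multiway partition of $V$ is a partition $Q_1,\dots,Q_k$ of $V$ with $Q_\ell=Q_\ell^T$ and $(\ell,\ell)\in Q_\ell$ for every $\ell\in[k]$. -}

module Defs where

open import Data.Bool using (Bool; true; false; _∧_; _∨_; if_then_else_)
open import Data.Nat as ℕ using (ℕ; zero; suc)
open import Data.Integer using (+_)
open import Data.Fin using (Fin; zero; suc; toℕ; _≟_)
open import Data.Rational using (ℚ; _/_; _+_; _-_; _*_; _⊓_; 0ℚ; 1ℚ)
open import Relation.Nullary.Decidable using (⌊_⌋)
open import Relation.Binary.PropositionalEquality using (_≡_)
open import Data.Product using (_×_)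

ℕ→ℚ : ℕ → ℚ
ℕ→ℚ n = + n / 1

sumFin : ∀ n → (Fin n → ℚ) → ℚ
sumFin zero    f = 0ℚ
sumFin (suc n) f = f zero + sumFin n (λ i → f (suc i))

countFin : ∀ n → (Fin n → Bool) → ℕ
countFin zero    p = 0
countFin (suc n) p = (if p zero then 1 else 0) ℕ.+ countFin n (λ i → p (suc i))

anyFin : ∀ n → (Fin n → Bool) → Bool
anyFin zero    p = false
anyFin (suc n) p = p zero ∨ anyFin n (λ i → p (suc i))

-- V = [k] × [k] (0-based indices), subsets of V as decidable predicates
Subset : ℕ → Set
Subset k = Fin k → Fin k → Bool

card : ∀ {k} → Subset k → ℕ
card {k} S = sumℕ k (λ i → countFin k (λ j → S i j))
  where
  sumℕ : ∀ n → (Fin n → ℕ) → ℕ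
  sumℕ zero    f = 0
  sumℕ (suc n) f = f zero ℕ.+ sumℕ n (λ i → f (suc i))

hasDiag : ∀ {k} → Subset k → Bool
hasDiag {k} S = anyFin k (λ ℓ → S ℓ ℓ)

_∩_ : ∀ {k} → Subset k → Subset k → Subset k
(A ∩ B) i j = A i j ∧ B i j

Row : ∀ {k} → Fin k → Subset k
Row i a b = ⌊ a ≟ i ⌋

Col : ∀ {k} → Fin k → Subset k
Col i a b = ⌊ b ≟ i ⌋

φn : ℕ → ℕ → ℚ
φn k a = ℕ→ℚ a ⊓ (ℕ→ℚ (7 ℕ.* k) * (+ 1 / 8))

φt : ℕ → ℕ → ℚ
φt k a = (ℕ→ℚ (3 ℕ.* k ℕ.* a) * (+ 1 / 8))
       ⊓ ((ℕ→ℚ (3 ℕ.* k) * (+ 1 / 8)) + ℕ→ℚ a - 1ℚ)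
       ⊓ (ℕ→ℚ (7 ℕ.* k) * (+ 1 / 8))

g : ∀ {k} → Subset k → ℚ
g {k} S = if hasDiag S then φt k (card S) else φn k (card S)

f : ∀ {k} → Subset k → ℚ
f {k} S = sumFin k (λ i → g (Row i ∩ S) + g (Col i ∩ S))

-- A multiway partition Q_1,…,Q_k of V is encoded by its labelling
-- q : V → [k], with Q_ℓ = {v ∈ V : q v = ℓ}.
Part : ∀ {k} → (Fin k → Fin k → Fin k) → Fin k → Subset k
Part q ℓ a b = ⌊ q a b ≟ ℓ ⌋

SymmetricMultiway : ∀ {k} → (Fin k → Fin k → Fin k) → Set
SymmetricMultiway {k} q = (∀ a b → q a b ≡ q b a) × (∀ ℓ → q ℓ ℓ ≡ ℓ)

{-# OPTIONS --safe #-}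
-- Rows, columns and labels are numbered from 0 and m = i*; rows 0, …, m are the low rows.
-- As Q_ℓ is symmetric and meets the diagonal only in (ℓ, ℓ), the sets R_i ∩ Q_ℓ and C_i ∩ Q_ℓ have
-- the same size and meet the diagonal iff i = ℓ, so Σ_ℓ f(Q_ℓ) = (2/8) Σ_i Σ_ℓ w(i, ℓ), where
-- w(i, ℓ) is 8φt (if i = ℓ) or 8φn (if not) of the number of cells of row i labelled ℓ.
-- The hypotheses force the labelling: a low row i carries the labels 0, …, i − 1 once each and
-- the label i on its k − i cells from the diagonal on; a high row i carries 1, …, m once each,
-- i on the diagonal and 0 on its remaining d = k − 1 − m cells.  So a low row weighs at least
-- 8i + 8φt(k − i) ≥ min(7k + 8i, 11k − 8), and a high row 8φn(d) + 8m + 3k.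
-- If 8d ≤ 7k, every row weighs at least min(7k + 8i, 11k − 8), and these bounds add up to
-- 10k² − 6k − 1 + r² with r the parity of k − 1.  If 8d > 7k, the low rows weigh at least
-- 7k + 8i and the high rows 10k + 8m, which is more than enough because then m < d.
module Submission where

open import Defs
open import Data.Nat using (ℕ; suc)
open import Data.Fin using (Fin; toℕ)
open import Relation.Binary.PropositionalEquality using (_≡_)

module Sums where

  open import Data.Nat using (ℕ; zero; suc; _+_; _*_; _∸_; _≤_; _<_; z≤n; s≤s; z<s; s<s)
  open import Data.Nat.Properties using (+-0-commutativeMonoid; +-mono-≤; +-assoc)
  open import Data.Nat.Solver using (module +-*-Solver)
  open import Data.Fin using (Fin; zero; suc; toℕ)
  open import Function using (_∘_)
  open import Relation.Binary.PropositionalEquality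
  open import Algebra.Properties.CommutativeMonoid.Sum +-0-commutativeMonoid
    using (sum-syntax; sum-cong-≗)
  open +-*-Solver using (solve; _:+_; _:*_; _:=_; con)

  sumUpTo : ℕ → (ℕ → ℕ) → ℕ
  sumUpTo n F = ∑[ i < n ] F (toℕ i)

  ∑-mono-≤ : ∀ {n} {F G : Fin n → ℕ} → (∀ i → F i ≤ G i) → ∑[ i < n ] F i ≤ ∑[ i < n ] G i
  ∑-mono-≤ {zero}  _   = z≤n
  ∑-mono-≤ {suc n} F≤G = +-mono-≤ (F≤G zero) (∑-mono-≤ (F≤G ∘ suc))

  ∑-≥-const : ∀ {n} {F : Fin n → ℕ} c → (∀ i → c ≤ F i) → n * c ≤ ∑[ i < n ] F i
  ∑-≥-const {zero}  c _   = z≤n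
  ∑-≥-const {suc n} c c≤F = +-mono-≤ (c≤F zero) (∑-≥-const c (c≤F ∘ suc))

  ∑-≥-split : ∀ {n} a (A : ℕ → ℕ) c {F : Fin n → ℕ} → a ≤ n →
              (∀ i → toℕ i < a → A (toℕ i) ≤ F i) → (∀ i → a ≤ toℕ i → c ≤ F i) →
              sumUpTo a A + (n ∸ a) * c ≤ ∑[ i < n ] F i
  ∑-≥-split zero A c _ _ c≤F = ∑-≥-const c (λ i → c≤F i z≤n)
  ∑-≥-split {suc n} (suc a) A c {F} (s≤s a≤n) A≤F c≤F = begin
    A 0 + sumUpTo a (A ∘ suc) + (n ∸ a) * c    ≡⟨ +-assoc (A 0) _ _ ⟩
    A 0 + (sumUpTo a (A ∘ suc) + (n ∸ a) * c)  ≤⟨ +-mono-≤ (A≤F zero z<s) rest ⟩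
    F zero + ∑[ i < n ] F (suc i)              ∎
    where
    open Data.Nat.Properties.≤-Reasoning
    rest : sumUpTo a (A ∘ suc) + (n ∸ a) * c ≤ ∑[ i < n ] F (suc i)
    rest = ∑-≥-split a (A ∘ suc) c a≤n (λ i → A≤F (suc i) ∘ s<s) (λ i → c≤F (suc i) ∘ s≤s)

  sumUpTo-arithmetic : ∀ n c b → sumUpTo n (λ x → c + 2 * b * x) + b * n ≡ n * c + b * (n * n)
  sumUpTo-arithmetic zero    c b = solve 1 (λ b → b :* con 0 := con 0 :+ b :* con 0) refl b
  sumUpTo-arithmetic (suc n) c b = begin
    c + 2 * b * 0 + S + b * suc n
      ≡⟨ solve 4 (λ c b S n → c :+ con 2 :* b :* con 0 :+ S :+ b :* (con 1 :+ n)
          := S :+ b :* n :+ (c :+ b)) refl c b S n ⟩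
    S + b * n + (c + b)
      ≡⟨ cong (λ t → t + b * n + (c + b)) shift ⟩
    S′ + b * n + (c + b)
      ≡⟨ cong (_+ (c + b)) (sumUpTo-arithmetic n (c + 2 * b) b) ⟩
    n * (c + 2 * b) + b * (n * n) + (c + b)
      ≡⟨ solve 3 (λ n c b → n :* (c :+ con 2 :* b) :+ b :* (n :* n) :+ (c :+ b)
          := (con 1 :+ n) :* c :+ b :* ((con 1 :+ n) :* (con 1 :+ n))) refl n c b ⟩
    suc n * c + b * (suc n * suc n) ∎
    where
    open ≡-Reasoning
    S  = sumUpTo n (λ x → c + 2 * b * suc x)
    S′ = sumUpTo n (λ x → (c + 2 * b) + 2 * b * x)
    shift : S ≡ S′
    shift = sum-cong-≗ {n} (λ i →
      solve 3 (λ c b x → c :+ con 2 :* b :* (con 1 :+ x) := c :+ con 2 :* b :+ con 2 :* b :* x) refl c b (toℕ i))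

module Counting where

  open import Data.Bool using (Bool; true; false; T; if_then_else_; _∧_; _∨_)
  open import Data.Bool.Properties using (∨-identityʳ)
  open import Data.Nat using (ℕ; zero; suc; _+_; _*_; _∸_; _≤_; _≤ᵇ_; _<ᵇ_; z≤n; s≤s)
  open import Data.Nat.Properties
    using (+-0-commutativeMonoid; +-mono-≤; *-monoʳ-≤; ≤-refl; ≤-trans; ≤-reflexive; m≤m+n; m≤n+m;
           +-suc; +-identityʳ; *-identityʳ; *-suc; *-zeroʳ; 0∸n≡0)
  open import Data.Fin using (Fin; zero; suc; toℕ; _≟_)
  open import Data.Fin.Properties using (suc-injective)
  open import Data.Empty using (⊥-elim)
  open import Data.Unit using (tt)
  open import Function using (_∘_)
  open import Relation.Nullary.Decidable using (⌊_⌋; ⌊⌋-map′)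
  open import Relation.Binary.PropositionalEquality
  open import Algebra.Properties.CommutativeMonoid.Sum +-0-commutativeMonoid
    using (sum-syntax; sum-cong-≗; ∑-comm; ∑-distrib-+)

  ind : Bool → ℕ
  ind b = if b then 1 else 0

  ind-mono : ∀ {a b} → (T a → T b) → ind a ≤ ind b
  ind-mono {false}         _   = z≤n
  ind-mono {true}  {true}  _   = ≤-refl
  ind-mono {true}  {false} a⇒b = ⊥-elim (a⇒b tt)

  countFin≡∑ : ∀ n (p : Fin n → Bool) → countFin n p ≡ ∑[ b < n ] ind (p b)
  countFin≡∑ zero    p = refl
  countFin≡∑ (suc n) p = cong (ind (p zero) +_) (countFin≡∑ n (p ∘ suc))

  countFin-cong : ∀ n {p p′ : Fin n → Bool} → (∀ b → p b ≡ p′ b) → countFin n p ≡ countFin n p′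
  countFin-cong zero    _  = refl
  countFin-cong (suc n) eq = cong₂ (λ x y → ind x + y) (eq zero) (countFin-cong n (eq ∘ suc))

  countFin-mono : ∀ n {p p′ : Fin n → Bool} → (∀ b → T (p b) → T (p′ b)) → countFin n p ≤ countFin n p′
  countFin-mono zero    _ = z≤n
  countFin-mono (suc n) p⇒p′ = +-mono-≤ (ind-mono (p⇒p′ zero)) (countFin-mono n (p⇒p′ ∘ suc))

  countFin-mono-except : ∀ n {p p′ : Fin n → Bool} (j : Fin n) →
                         (∀ b → b ≢ j → T (p b) → T (p′ b)) → countFin n p ≤ suc (countFin n p′)
  countFin-mono-except (suc n) {p} {p′} zero p⇒p′ =
    ≤-trans (+-mono-≤ (ind-mono {p zero} {true} _) (countFin-mono n (λ b → p⇒p′ (suc b) λ ())))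
            (s≤s (m≤n+m _ (ind (p′ zero))))
  countFin-mono-except (suc n) {p} {p′} (suc j) p⇒p′ =
    subst (countFin (suc n) p ≤_) (+-suc (ind (p′ zero)) _)
      (+-mono-≤ (ind-mono (p⇒p′ zero λ ())) (countFin-mono-except n j (λ b b≢j → p⇒p′ (suc b) (b≢j ∘ suc-injective))))

  countFin-≥1 : ∀ n {p : Fin n → Bool} (b : Fin n) → T (p b) → 1 ≤ countFin n p
  countFin-≥1 (suc n) {p} zero    pb = ≤-trans (ind-mono {true} {p zero} (λ _ → pb)) (m≤m+n _ _)
  countFin-≥1 (suc n) {p} (suc b) pb = ≤-trans (countFin-≥1 n b pb) (m≤n+m _ (ind (p zero)))

  c≤c*countFin : ∀ n c {p : Fin n → Bool} (b : Fin n) → T (p b) → c ≤ c * countFin n p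
  c≤c*countFin n c b pb = ≤-trans (≤-reflexive (sym (*-identityʳ c))) (*-monoʳ-≤ c (countFin-≥1 n b pb))

  countFin-false : ∀ n → countFin n (λ _ → false) ≡ 0
  countFin-false zero    = refl
  countFin-false (suc n) = countFin-false n

  countFin-prefix : ∀ n y → y ≤ n → countFin n (λ b → toℕ b <ᵇ y) ≡ y
  countFin-prefix n       zero    _         = countFin-false n
  countFin-prefix (suc n) (suc y) (s≤s y≤n) = cong suc (countFin-prefix n y y≤n)

  countFin-suffix : ∀ n y → countFin n (λ b → y ≤ᵇ toℕ b) ≡ n ∸ y
  countFin-suffix zero    y       = sym (0∸n≡0 y)
  countFin-suffix (suc n) zero    = cong suc (countFin-suffix n zero)
  countFin-suffix (suc n) (suc y) =
    trans (countFin-cong n (λ b → suc-≤ᵇ-suc y (toℕ b))) (countFin-suffix n y)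
    where
    suc-≤ᵇ-suc : ∀ y x → (suc y ≤ᵇ suc x) ≡ (y ≤ᵇ x)
    suc-≤ᵇ-suc zero    x = refl
    suc-≤ᵇ-suc (suc y) x = refl

  countFin-≟∧ : ∀ n (i : Fin n) (p : Fin n → Bool) → countFin n (λ b → ⌊ b ≟ i ⌋ ∧ p b) ≡ ind (p i)
  countFin-≟∧ (suc n) zero    p = trans (cong (ind (p zero) +_) (countFin-false n)) (+-identityʳ _)
  countFin-≟∧ (suc n) (suc i) p =
    trans (countFin-cong n (λ b → cong (_∧ p (suc b)) (⌊⌋-map′ _ _ (b ≟ i)))) (countFin-≟∧ n i (p ∘ suc))

  anyFin-≟∧ : ∀ n (i : Fin n) (p : Fin n → Bool) → anyFin n (λ b → ⌊ b ≟ i ⌋ ∧ p b) ≡ p i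
  anyFin-≟∧ (suc n) zero    p = trans (cong (p zero ∨_) (anyFin-false n)) (∨-identityʳ (p zero))
    where
    anyFin-false : ∀ n → anyFin n (λ _ → false) ≡ false
    anyFin-false zero    = refl
    anyFin-false (suc n) = anyFin-false n
  anyFin-≟∧ (suc n) (suc i) p =
    trans (anyFin-cong n (λ b → cong (_∧ p (suc b)) (⌊⌋-map′ _ _ (b ≟ i)))) (anyFin-≟∧ n i (p ∘ suc))
    where
    anyFin-cong : ∀ n {p p′ : Fin n → Bool} → (∀ b → p b ≡ p′ b) → anyFin n p ≡ anyFin n p′
    anyFin-cong zero    _  = refl
    anyFin-cong (suc n) eq = cong₂ _∨_ (eq zero) (anyFin-cong n (eq ∘ suc))

  ∑-if : ∀ n (p : Fin n → Bool) c → ∑[ b < n ] (if p b then c else 0) ≡ c * countFin n p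
  ∑-if zero    p c = sym (*-zeroʳ c)
  ∑-if (suc n) p c with p zero
  ... | true  = trans (cong (c +_) (∑-if n (p ∘ suc) c)) (sym (*-suc c _))
  ... | false = ∑-if n (p ∘ suc) c

  ∑-if₂ : ∀ n (p p′ : Fin n → Bool) a b →
          ∑[ x < n ] ((if p x then a else 0) + (if p′ x then b else 0)) ≡ a * countFin n p + b * countFin n p′
  ∑-if₂ n p p′ a b = trans (∑-distrib-+ {n} _ _) (cong₂ _+_ (∑-if n p a) (∑-if n p′ b))

  -- `card` sums with a helper local to its definition; `cardSum` names that helper, by unification.
  mutual
    cardSum : ∀ {k} → Subset k → ∀ n → (Fin n → ℕ) → ℕ
    cardSum = _

    card-suc : ∀ {k} (S : Subset (suc k)) →
               card S ≡ countFin (suc k) (S zero) + cardSum S k (λ a → countFin (suc k) (S (suc a)))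
    card-suc {k} S with countFin (suc k) (S zero)
    ... | _ with suc k | S | (λ a → countFin (suc k) (S (suc a)))
    ... | _ | _ | _ = refl

  cardSum≡∑ : ∀ {k} (S : Subset k) n (F : Fin n → ℕ) → cardSum S n F ≡ ∑[ a < n ] F a
  cardSum≡∑ S zero    F = refl
  cardSum≡∑ S (suc n) F = cong (F zero +_) (cardSum≡∑ S n (F ∘ suc))

  card≡∑∑ : ∀ {k} (S : Subset k) → card S ≡ ∑[ a < k ] ∑[ b < k ] ind (S a b)
  card≡∑∑ {zero}  S = refl
  card≡∑∑ {suc k} S = begin
    card S                                               ≡⟨ card-suc S ⟩
    countFin (suc k) (S zero) + cardSum S k (countFin (suc k) ∘ S ∘ suc)
                                                         ≡⟨ cong (countFin (suc k) (S zero) +_) (cardSum≡∑ S k _) ⟩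
    ∑[ a < suc k ] countFin (suc k) (S a)                ≡⟨ sum-cong-≗ {suc k} (λ a → countFin≡∑ (suc k) (S a)) ⟩
    ∑[ a < suc k ] ∑[ b < suc k ] ind (S a b)            ∎
    where open ≡-Reasoning

  card-Col∩ : ∀ {k} (i : Fin k) (P : Subset k) → card (Col i ∩ P) ≡ countFin k (λ a → P a i)
  card-Col∩ {k} i P = begin
    card (Col i ∩ P)                                     ≡⟨ card≡∑∑ (Col i ∩ P) ⟩
    ∑[ a < k ] ∑[ b < k ] ind (⌊ b ≟ i ⌋ ∧ P a b)        ≡⟨ sum-cong-≗ {k} (λ a → sym (countFin≡∑ k _)) ⟩
    ∑[ a < k ] countFin k (λ b → ⌊ b ≟ i ⌋ ∧ P a b)      ≡⟨ sum-cong-≗ {k} (λ a → countFin-≟∧ k i (P a)) ⟩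
    ∑[ a < k ] ind (P a i)                               ≡⟨ sym (countFin≡∑ k _) ⟩
    countFin k (λ a → P a i)                             ∎
    where open ≡-Reasoning

  card-Row∩ : ∀ {k} (i : Fin k) (P : Subset k) → card (Row i ∩ P) ≡ countFin k (P i)
  card-Row∩ {k} i P = begin
    card (Row i ∩ P)                                     ≡⟨ card≡∑∑ (Row i ∩ P) ⟩
    ∑[ a < k ] ∑[ b < k ] ind (⌊ a ≟ i ⌋ ∧ P a b)        ≡⟨ ∑-comm (λ a b → ind (⌊ a ≟ i ⌋ ∧ P a b)) ⟩
    ∑[ b < k ] ∑[ a < k ] ind (⌊ a ≟ i ⌋ ∧ P a b)        ≡⟨ sum-cong-≗ {k} (λ b → sym (countFin≡∑ k _)) ⟩
    ∑[ b < k ] countFin k (λ a → ⌊ a ≟ i ⌋ ∧ P a b)      ≡⟨ sum-cong-≗ {k} (λ b → countFin-≟∧ k i (λ a → P a b)) ⟩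
    ∑[ b < k ] ind (P i b)                               ≡⟨ sym (countFin≡∑ k _) ⟩
    countFin k (P i)                                     ∎
    where open ≡-Reasoning

  hasDiag-Row∩ : ∀ {k} (i : Fin k) (P : Subset k) → hasDiag (Row i ∩ P) ≡ P i i
  hasDiag-Row∩ {k} i P = anyFin-≟∧ k i (λ ℓ → P ℓ ℓ)

  hasDiag-Col∩ : ∀ {k} (i : Fin k) (P : Subset k) → hasDiag (Col i ∩ P) ≡ P i i
  hasDiag-Col∩ = hasDiag-Row∩

module Weights where

  open import Data.Bool using (Bool; if_then_else_)
  open import Data.Nat using (ℕ; zero; suc; _+_; _*_; _⊓_; _≤_; z≤n; s≤s)
  open import Data.Nat.Properties
    using (+-0-commutativeMonoid; ⊓-glb; ⊓-mono-≤; ⊓-monoˡ-≤; *-monoʳ-≤; *-monoˡ-≤; +-monoʳ-≤;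
           m≤m+n; m≤m*n; ≤-refl; ≤-trans)
  open import Algebra.Properties.CommutativeMonoid.Sum +-0-commutativeMonoid using (sum-syntax)

  -- 8 φn and 8 φt, which take values in ℕ; φt₈ k 0 = 0 is 8 φt k 0 as soon as 3k ≥ 8.
  φn₈ : ℕ → ℕ → ℕ
  φn₈ k a = (8 * a) ⊓ (7 * k)

  φt₈ : ℕ → ℕ → ℕ
  φt₈ k zero    = 0
  φt₈ k (suc a) = (3 * k * suc a) ⊓ (3 * k + 8 * a) ⊓ (7 * k)

  φ₈ : ℕ → Bool → ℕ → ℕ
  φ₈ k diagonal = if diagonal then φt₈ k else φn₈ k

  g₈ : ∀ {k} → Subset k → ℕ
  g₈ {k} S = φ₈ k (hasDiag S) (card S)

  f₈ : ∀ {k} → Subset k → ℕ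
  f₈ {k} S = ∑[ i < k ] (g₈ (Row i ∩ S) + g₈ (Col i ∩ S))

  φn₈-mono : ∀ k {a b} → a ≤ b → φn₈ k a ≤ φn₈ k b
  φn₈-mono k a≤b = ⊓-monoˡ-≤ (7 * k) (*-monoʳ-≤ 8 a≤b)

  φt₈-mono : ∀ k {a b} → a ≤ b → φt₈ k a ≤ φt₈ k b
  φt₈-mono k {zero}              _         = z≤n
  φt₈-mono k {suc a} {suc b} (s≤s a≤b) =
    ⊓-mono-≤ (⊓-mono-≤ (*-monoʳ-≤ (3 * k) (s≤s a≤b)) (+-monoʳ-≤ (3 * k) (*-monoʳ-≤ 8 a≤b))) (≤-refl {7 * k})

  φn₈-≥-8 : ∀ {k a} → 8 ≤ 3 * k → 1 ≤ a → 8 ≤ φn₈ k a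
  φn₈-≥-8 {k} 8≤3k 1≤a = ⊓-glb (*-monoʳ-≤ 8 1≤a) (≤-trans 8≤3k (*-monoˡ-≤ k (m≤m+n 3 4)))

  φt₈-≥-3k : ∀ {k a} → 1 ≤ a → 3 * k ≤ φt₈ k a
  φt₈-≥-3k {k} {suc a} _ = ⊓-glb (⊓-glb (m≤m*n (3 * k) (suc a)) (m≤m+n (3 * k) (8 * a))) (*-monoˡ-≤ k (m≤m+n 3 4))

module Scaling where

  open import Data.Bool using (true; false; if_then_else_)
  open import Data.Nat as ℕ using (ℕ; zero; suc; z≤n)
  import Data.Nat.Properties as ℕP
  open import Data.Integer as ℤ using (+_)
  import Data.Integer.Properties as ℤP
  open import Data.Rational using (ℚ; mkℚ; _/_; _+_; _*_; _-_; _≤_; -_; *≤*; 1ℚ)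
  import Data.Rational.Properties as ℚP
  import Data.Nat.Coprimality as Coprimality
  open import Data.Rational.Solver using (module +-*-Solver)
  open import Data.Fin using (Fin; zero; suc)
  open import Function using (_∘_)
  open import Relation.Binary.PropositionalEquality
  open import Algebra.Properties.CommutativeMonoid.Sum ℕP.+-0-commutativeMonoid using (sum-syntax)
  open +-*-Solver using (solve; _:+_; _:-_; _:=_; con)
  open Weights

  ⅛ : ℚ
  ⅛ = + 1 / 8

  ℕ→ℚ≡mkℚ : ∀ n → ℕ→ℚ n ≡ mkℚ (+ n) 0 (Coprimality.sym (Coprimality.1-coprimeTo n))
  ℕ→ℚ≡mkℚ n = ℚP.normalize-coprime _

  ℕ→ℚ-+ : ∀ a b → ℕ→ℚ (a ℕ.+ b) ≡ ℕ→ℚ a + ℕ→ℚ b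
  ℕ→ℚ-+ a b rewrite ℕ→ℚ≡mkℚ a | ℕ→ℚ≡mkℚ b =
    cong (_/ 1) (trans (ℤP.pos-+ a b) (sym (cong₂ ℤ._+_ (ℤP.*-identityʳ (+ a)) (ℤP.*-identityʳ (+ b)))))

  ℕ→ℚ-* : ∀ a b → ℕ→ℚ (a ℕ.* b) ≡ ℕ→ℚ a * ℕ→ℚ b
  ℕ→ℚ-* a b rewrite ℕ→ℚ≡mkℚ a | ℕ→ℚ≡mkℚ b = cong (_/ 1) (ℤP.pos-* a b)

  ℕ→ℚ-mono : ∀ {a b} → a ℕ.≤ b → ℕ→ℚ a ≤ ℕ→ℚ b
  ℕ→ℚ-mono {a} {b} a≤b rewrite ℕ→ℚ≡mkℚ a | ℕ→ℚ≡mkℚ b =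
    *≤* (subst₂ ℤ._≤_ (sym (ℤP.*-identityʳ (+ a))) (sym (ℤP.*-identityʳ (+ b))) (ℤ.+≤+ a≤b))

  *⅛-mono : ∀ {a b} → a ℕ.≤ b → ℕ→ℚ a * ⅛ ≤ ℕ→ℚ b * ⅛
  *⅛-mono a≤b = ℚP.*-monoʳ-≤-nonNeg ⅛ (ℕ→ℚ-mono a≤b)

  *⅛-≤ : ∀ {a b q} → a ℕ.≤ b → ℕ→ℚ b * ⅛ ≡ q → ℕ→ℚ a * ⅛ ≤ q
  *⅛-≤ a≤b refl = *⅛-mono a≤b

  *⅛-+ : ∀ a b → ℕ→ℚ (a ℕ.+ b) * ⅛ ≡ ℕ→ℚ a * ⅛ + ℕ→ℚ b * ⅛
  *⅛-+ a b = trans (cong (_* ⅛) (ℕ→ℚ-+ a b)) (ℚP.*-distribʳ-+ ⅛ (ℕ→ℚ a) (ℕ→ℚ b))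

  *⅛-+8* : ∀ a c → ℕ→ℚ (a ℕ.+ 8 ℕ.* c) * ⅛ ≡ ℕ→ℚ a * ⅛ + ℕ→ℚ c
  *⅛-+8* a c = begin
    ℕ→ℚ (a ℕ.+ 8 ℕ.* c) * ⅛
      ≡⟨ *⅛-+ a (8 ℕ.* c) ⟩
    ℕ→ℚ a * ⅛ + ℕ→ℚ (8 ℕ.* c) * ⅛
      ≡⟨ cong (λ x → ℕ→ℚ a * ⅛ + x * ⅛) (trans (ℕ→ℚ-* 8 c) (ℚP.*-comm (ℕ→ℚ 8) (ℕ→ℚ c))) ⟩
    ℕ→ℚ a * ⅛ + ℕ→ℚ c * ℕ→ℚ 8 * ⅛
      ≡⟨ cong (_+_ (ℕ→ℚ a * ⅛)) (ℚP.*-assoc (ℕ→ℚ c) (ℕ→ℚ 8) ⅛) ⟩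
    ℕ→ℚ a * ⅛ + ℕ→ℚ c * 1ℚ
      ≡⟨ cong (_+_ (ℕ→ℚ a * ⅛)) (ℚP.*-identityʳ (ℕ→ℚ c)) ⟩
    ℕ→ℚ a * ⅛ + ℕ→ℚ c ∎
    where open ≡-Reasoning

  φn₈-≤-φn : ∀ k a → ℕ→ℚ (φn₈ k a) * ⅛ ≤ φn k a
  φn₈-≤-φn k a = ℚP.⊓-glb (*⅛-≤ (ℕP.m⊓n≤m (8 ℕ.* a) (7 ℕ.* k)) eighth) (*⅛-mono (ℕP.m⊓n≤n (8 ℕ.* a) (7 ℕ.* k)))
    where
    eighth : ℕ→ℚ (8 ℕ.* a) * ⅛ ≡ ℕ→ℚ a
    eighth = trans (*⅛-+8* 0 a) (ℚP.+-identityˡ (ℕ→ℚ a))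

  φt₈-≤-φt : ∀ {k} → 8 ℕ.≤ 3 ℕ.* k → ∀ a → ℕ→ℚ (φt₈ k a) * ⅛ ≤ φt k a
  φt₈-≤-φt {k} 8≤3k zero = ℚP.⊓-glb (ℚP.⊓-glb (*⅛-mono {0} {3 ℕ.* k ℕ.* 0} z≤n) middle) (*⅛-mono {0} {7 ℕ.* k} z≤n)
    where
    r = 3 ℕ.* k ℕ.∸ 8
    middle : ℕ→ℚ 0 * ⅛ ≤ ℕ→ℚ (3 ℕ.* k) * ⅛ + ℕ→ℚ 0 - 1ℚ
    middle = *⅛-≤ {0} {r} z≤n (begin
      ℕ→ℚ r * ⅛
        ≡⟨ solve 1 (λ x → x := x :+ con 1ℚ :+ con (ℕ→ℚ 0) :- con 1ℚ) refl (ℕ→ℚ r * ⅛) ⟩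
      ℕ→ℚ r * ⅛ + 1ℚ + ℕ→ℚ 0 - 1ℚ
        ≡⟨ cong (λ x → x + ℕ→ℚ 0 - 1ℚ) (sym (*⅛-+8* r 1)) ⟩
      ℕ→ℚ (r ℕ.+ 8 ℕ.* 1) * ⅛ + ℕ→ℚ 0 - 1ℚ
        ≡⟨ cong (λ n → ℕ→ℚ n * ⅛ + ℕ→ℚ 0 - 1ℚ) (ℕP.m∸n+n≡m 8≤3k) ⟩
      ℕ→ℚ (3 ℕ.* k) * ⅛ + ℕ→ℚ 0 - 1ℚ ∎)
      where open ≡-Reasoning
  φt₈-≤-φt {k} _ (suc a) = ℚP.⊓-glb (ℚP.⊓-glb
    (*⅛-mono (ℕP.≤-trans ≤A⊓B (ℕP.m⊓n≤m A B)))
    (*⅛-≤ (ℕP.≤-trans ≤A⊓B (ℕP.m⊓n≤n A B)) middle))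
    (*⅛-mono (ℕP.m⊓n≤n (A ℕ.⊓ B) C))
    where
    A = 3 ℕ.* k ℕ.* suc a
    B = 3 ℕ.* k ℕ.+ 8 ℕ.* a
    C = 7 ℕ.* k
    ≤A⊓B : φt₈ k (suc a) ℕ.≤ A ℕ.⊓ B
    ≤A⊓B = ℕP.m⊓n≤m (A ℕ.⊓ B) C
    middle : ℕ→ℚ B * ⅛ ≡ ℕ→ℚ (3 ℕ.* k) * ⅛ + ℕ→ℚ (suc a) - 1ℚ
    middle = begin
      ℕ→ℚ B * ⅛
        ≡⟨ *⅛-+8* (3 ℕ.* k) a ⟩
      ℕ→ℚ (3 ℕ.* k) * ⅛ + ℕ→ℚ a
        ≡⟨ solve 2 (λ x y → x :+ y := x :+ (con 1ℚ :+ y) :- con 1ℚ) refl (ℕ→ℚ (3 ℕ.* k) * ⅛) (ℕ→ℚ a) ⟩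
      ℕ→ℚ (3 ℕ.* k) * ⅛ + (1ℚ + ℕ→ℚ a) - 1ℚ
        ≡⟨ cong (λ x → ℕ→ℚ (3 ℕ.* k) * ⅛ + x - 1ℚ) (sym (ℕ→ℚ-+ 1 a)) ⟩
      ℕ→ℚ (3 ℕ.* k) * ⅛ + ℕ→ℚ (suc a) - 1ℚ ∎
      where open ≡-Reasoning

  φ₈-≤ : ∀ {k} → 8 ℕ.≤ 3 ℕ.* k → ∀ diagonal a → ℕ→ℚ (φ₈ k diagonal a) * ⅛ ≤ (if diagonal then φt k a else φn k a)
  φ₈-≤ 8≤3k    true  a = φt₈-≤-φt 8≤3k a
  φ₈-≤ {k} _   false a = φn₈-≤-φn k a

  g₈-≤-g : ∀ {k} → 8 ℕ.≤ 3 ℕ.* k → (S : Subset k) → ℕ→ℚ (g₈ S) * ⅛ ≤ g S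
  g₈-≤-g 8≤3k S = φ₈-≤ 8≤3k (hasDiag S) (card S)

  ∑-≤-sumFin : ∀ n {F : Fin n → ℕ} {G : Fin n → ℚ} →
               (∀ i → ℕ→ℚ (F i) * ⅛ ≤ G i) → ℕ→ℚ (∑[ i < n ] F i) * ⅛ ≤ sumFin n G
  ∑-≤-sumFin zero    _ = ℚP.≤-refl
  ∑-≤-sumFin (suc n) {F} {G} F≤G = begin
    ℕ→ℚ (F zero ℕ.+ ∑F′) * ⅛            ≡⟨ *⅛-+ (F zero) ∑F′ ⟩
    ℕ→ℚ (F zero) * ⅛ + ℕ→ℚ ∑F′ * ⅛      ≤⟨ ℚP.+-mono-≤ (F≤G zero) (∑-≤-sumFin n (F≤G ∘ suc)) ⟩
    G zero + sumFin n (G ∘ suc)          ∎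
    where
    open ℚP.≤-Reasoning
    ∑F′ = ∑[ i < n ] F (suc i)

  f₈-≤-f : ∀ {k} → 8 ℕ.≤ 3 ℕ.* k → (S : Subset k) → ℕ→ℚ (f₈ S) * ⅛ ≤ f S
  f₈-≤-f {k} 8≤3k S = ∑-≤-sumFin k line
    where
    open ℚP.≤-Reasoning
    line : ∀ i → ℕ→ℚ (g₈ (Row i ∩ S) ℕ.+ g₈ (Col i ∩ S)) * ⅛ ≤ g (Row i ∩ S) + g (Col i ∩ S)
    line i = begin
      ℕ→ℚ (g₈ (Row i ∩ S) ℕ.+ g₈ (Col i ∩ S)) * ⅛
        ≡⟨ *⅛-+ (g₈ (Row i ∩ S)) (g₈ (Col i ∩ S)) ⟩
      ℕ→ℚ (g₈ (Row i ∩ S)) * ⅛ + ℕ→ℚ (g₈ (Col i ∩ S)) * ⅛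
        ≤⟨ ℚP.+-mono-≤ (g₈-≤-g 8≤3k (Row i ∩ S)) (g₈-≤-g 8≤3k (Col i ∩ S)) ⟩
      g (Row i ∩ S) + g (Col i ∩ S) ∎

  target-≤ : ∀ k W → 10 ℕ.* k ℕ.* k ℕ.≤ W ℕ.+ 6 ℕ.* k ℕ.+ 1 →
             (ℕ→ℚ (10 ℕ.* k ℕ.* k) - ℕ→ℚ (6 ℕ.* k) - ℕ→ℚ 1) * (+ 1 / 4) ≤ ℕ→ℚ (W ℕ.+ W) * ⅛
  target-≤ k W bound = begin
    (A - B - 1ℚ) * ¼               ≤⟨ ℚP.*-monoʳ-≤-nonNeg ¼ (ℚP.+-monoˡ-≤ (- 1ℚ) (ℚP.+-monoˡ-≤ (- B) A≤Y+B+1)) ⟩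
    (Y + B + 1ℚ - B - 1ℚ) * ¼      ≡⟨ cong (_* ¼) (solve 2 (λ y b → y :+ b :+ con 1ℚ :- b :- con 1ℚ := y) refl Y B) ⟩
    Y * (⅛ + ⅛)                    ≡⟨ ℚP.*-distribˡ-+ Y ⅛ ⅛ ⟩
    Y * ⅛ + Y * ⅛                  ≡⟨ sym (*⅛-+ W W) ⟩
    ℕ→ℚ (W ℕ.+ W) * ⅛              ∎
    where
    open ℚP.≤-Reasoning
    ¼ = + 1 / 4
    A = ℕ→ℚ (10 ℕ.* k ℕ.* k)
    B = ℕ→ℚ (6 ℕ.* k)
    Y = ℕ→ℚ W
    A≤Y+B+1 : A ≤ Y + B + 1ℚ
    A≤Y+B+1 = subst (A ≤_) (trans (ℕ→ℚ-+ (W ℕ.+ 6 ℕ.* k) 1) (cong (_+ 1ℚ) (ℕ→ℚ-+ W (6 ℕ.* k)))) (ℕ→ℚ-mono bound)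

module RowArithmetic where

  open import Data.Nat using (ℕ; zero; suc; _+_; _*_; _∸_; _⊓_; _≤_; _<_; _≤?_; z≤n; s≤s)
  open import Data.Nat.Properties
    using (≤-refl; ≤-trans; ≤-reflexive; ≤-pred; n≤1+n; m≤m+n; +-mono-≤; +-monoˡ-≤; +-monoʳ-≤; *-monoʳ-≤; *-monoˡ-≤;
           +-distribˡ-⊓; ⊓-glb; m⊓n≤m; m⊓n≤n; +-comm; +-suc; +-cancelʳ-≤; m+n∸m≡n; m≤n⇒∃[o]m+o≡n; ≰⇒>; ≤⇒≯)
  open import Relation.Nullary using (yes; no; contradiction)
  open import Data.Nat.Solver using (module +-*-Solver)
  open import Data.Product using (∃-syntax; _×_; _,_)
  open import Relation.Binary.PropositionalEquality
  open +-*-Solver using (solve; _:+_; _:*_; _:=_; con)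
  open Sums using (sumUpTo; sumUpTo-arithmetic)
  open Weights using (φt₈)

  half : ∀ n → ∃[ a ] ∃[ r ] r ≤ 1 × n ≡ a + (a + r)
  half zero          = 0 , 0 , z≤n , refl
  half (suc zero)    = 0 , 1 , s≤s z≤n , refl
  half (suc (suc n)) with half n
  ... | a , r , r≤1 , refl = suc a , r , r≤1 , cong suc (sym (+-suc a (a + r)))

  rowBound : ℕ → ℕ → ℕ
  rowBound K x = (7 * suc K + 8 * x) ⊓ (3 * suc K + 8 * K)

  rowBound-≤ : ∀ {K x} → 8 ≤ 3 * suc K → x ≤ K → rowBound K x ≤ 8 * x + φt₈ (suc K) (suc K ∸ x)
  rowBound-≤ {K} {x} 8≤3k x≤K with m≤n⇒∃[o]m+o≡n x≤K
  ... | c , refl = begin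
    rowBound (x + c) x                                     ≤⟨ ⊓-glb (⊓-glb ≤first ≤second) ≤third ⟩
    (8 * x + A) ⊓ (8 * x + B) ⊓ (8 * x + C)                ≡⟨ cong (_⊓ (8 * x + C)) (sym (+-distribˡ-⊓ (8 * x) A B)) ⟩
    (8 * x + A ⊓ B) ⊓ (8 * x + C)                          ≡⟨ sym (+-distribˡ-⊓ (8 * x) (A ⊓ B) C) ⟩
    8 * x + φt₈ k (suc c)                                  ≡⟨ cong (λ t → 8 * x + φt₈ k t) (sym k∸x) ⟩
    8 * x + φt₈ k (k ∸ x)                                  ∎
    where
    open Data.Nat.Properties.≤-Reasoning
    k = suc (x + c)
    A = 3 * k * suc c
    B = 3 * k + 8 * c
    C = 7 * k
    k∸x : k ∸ x ≡ suc c
    k∸x = trans (cong (_∸ x) (sym (+-suc x c))) (m+n∸m≡n x (suc c))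
    ≤second : rowBound (x + c) x ≤ 8 * x + B
    ≤second = ≤-trans (m⊓n≤n _ _) (≤-reflexive (solve 2 (λ x c →
      con 3 :* (con 1 :+ (x :+ c)) :+ con 8 :* (x :+ c)
        := con 8 :* x :+ (con 3 :* (con 1 :+ (x :+ c)) :+ con 8 :* c)) refl x c))
    ≤first : rowBound (x + c) x ≤ 8 * x + A
    ≤first = ≤-trans ≤second (begin
      8 * x + (3 * k + 8 * c)
        ≤⟨ +-monoʳ-≤ (8 * x) (+-monoʳ-≤ (3 * k) (*-monoˡ-≤ c 8≤3k)) ⟩
      8 * x + (3 * k + 3 * k * c)
        ≡⟨ cong (8 * x +_) (solve 2 (λ k c → k :+ k :* c := k :* (con 1 :+ c)) refl (3 * k) c) ⟩
      8 * x + A ∎)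
    ≤third : rowBound (x + c) x ≤ 8 * x + C
    ≤third = ≤-trans (m⊓n≤m _ _) (≤-reflexive (+-comm C (8 * x)))

  rowBound-small : ∀ {K} x → 2 * x + 1 ≤ K → 7 * suc K + 8 * x ≤ rowBound K x
  rowBound-small {K} x 2x+1≤K = ⊓-glb ≤-refl (begin
    7 * suc K + 8 * x
      ≡⟨ solve 2 (λ K x → con 7 :* (con 1 :+ K) :+ con 8 :* x
          := con 3 :* (con 1 :+ K) :+ con 4 :* K :+ con 4 :* (con 2 :* x :+ con 1)) refl K x ⟩
    3 * suc K + 4 * K + 4 * (2 * x + 1)
      ≤⟨ +-monoʳ-≤ (3 * suc K + 4 * K) (*-monoʳ-≤ 4 2x+1≤K) ⟩
    3 * suc K + 4 * K + 4 * K
      ≡⟨ solve 1 (λ K → con 3 :* (con 1 :+ K) :+ con 4 :* K :+ con 4 :* K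
          := con 3 :* (con 1 :+ K) :+ con 8 :* K) refl K ⟩
    3 * suc K + 8 * K ∎)
    where open Data.Nat.Properties.≤-Reasoning

  rowBound-large : ∀ {K} x → K ≤ 2 * x + 1 → 3 * suc K + 8 * K ≤ rowBound K x
  rowBound-large {K} x K≤2x+1 = ⊓-glb (begin
    3 * suc K + 8 * K
      ≡⟨ solve 1 (λ K → con 3 :* (con 1 :+ K) :+ con 8 :* K
          := con 3 :* (con 1 :+ K) :+ con 4 :* K :+ con 4 :* K) refl K ⟩
    3 * suc K + 4 * K + 4 * K
      ≤⟨ +-monoʳ-≤ (3 * suc K + 4 * K) (*-monoʳ-≤ 4 K≤2x+1) ⟩
    3 * suc K + 4 * K + 4 * (2 * x + 1)
      ≡⟨ solve 2 (λ K x → con 3 :* (con 1 :+ K) :+ con 4 :* K :+ con 4 :* (con 2 :* x :+ con 1)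
          := con 7 :* (con 1 :+ K) :+ con 8 :* x) refl K x ⟩
    7 * suc K + 8 * x ∎) ≤-refl
    where open Data.Nat.Properties.≤-Reasoning

  -- Tight up to r²: for odd k there is no slack at all.
  balanced-sum-bound : ∀ {K} a r → K ≡ a + (a + r) →
    10 * suc K * suc K ≤ sumUpTo a (λ x → 7 * suc K + 8 * x) + (suc K ∸ a) * (3 * suc K + 8 * K) + 6 * suc K + 1
  balanced-sum-bound a r refl = +-cancelʳ-≤ (4 * a) _ _ (begin
    10 * k * k + 4 * a
      ≤⟨ m≤m+n (10 * k * k + 4 * a) (r * r) ⟩
    10 * k * k + 4 * a + r * r
      ≡⟨ solve 2 (λ a r →
          let k = con 1 :+ (a :+ (a :+ r)) in
          con 10 :* k :* k :+ con 4 :* a :+ r :* r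
          := a :* (con 7 :* k) :+ con 4 :* (a :* a) :+ (con 1 :+ (a :+ r)) :* (con 3 :* k :+ con 8 :* (a :+ (a :+ r)))
          :+ con 6 :* k :+ con 1) refl a r ⟩
    a * (7 * k) + 4 * (a * a) + suc (a + r) * c + 6 * k + 1
      ≡⟨ cong₂ (λ s t → s + t * c + 6 * k + 1) (sym (sumUpTo-arithmetic a (7 * k) 4)) (sym k∸a) ⟩
    S + 4 * a + (k ∸ a) * c + 6 * k + 1
      ≡⟨ solve 4 (λ S T k a → S :+ con 4 :* a :+ T :+ con 6 :* k :+ con 1
          := S :+ T :+ con 6 :* k :+ con 1 :+ con 4 :* a) refl S ((k ∸ a) * c) k a ⟩
    S + (k ∸ a) * c + 6 * k + 1 + 4 * a ∎)
    where
    open Data.Nat.Properties.≤-Reasoning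
    k = suc (a + (a + r))
    c = 3 * k + 8 * (a + (a + r))
    S = sumUpTo a (λ x → 7 * k + 8 * x)
    k∸a : k ∸ a ≡ suc (a + r)
    k∸a = trans (cong (_∸ a) (sym (+-suc a (a + r)))) (m+n∸m≡n a (suc (a + r)))

  lopsided-sum-bound : ∀ {K} m d → K ≡ m + d → suc m ≤ d →
    10 * suc K * suc K ≤ sumUpTo (suc m) (λ x → 7 * suc K + 8 * x) + d * (10 * suc K + 8 * m) + 6 * suc K + 1
  lopsided-sum-bound m d refl m<d with m≤n⇒∃[o]m+o≡n m<d
  ... | e , refl = +-cancelʳ-≤ (4 * suc m) _ _ (begin
    10 * k * k + 4 * suc m
      ≤⟨ m≤m+n (10 * k * k + 4 * suc m) slack ⟩
    10 * k * k + 4 * suc m + slack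
      ≡⟨ solve 2 (λ m e →
          let k = con 1 :+ (m :+ (con 1 :+ m :+ e)) in
          con 10 :* k :* k :+ con 4 :* (con 1 :+ m)
          :+ (con 6 :* m :* m :+ con 12 :* m :+ con 5 :* e :* m :+ con 3 :* e :+ con 7)
          := (con 1 :+ m) :* (con 7 :* k) :+ con 4 :* ((con 1 :+ m) :* (con 1 :+ m))
          :+ (con 1 :+ m :+ e) :* (con 10 :* k :+ con 8 :* m) :+ con 6 :* k :+ con 1) refl m e ⟩
    suc m * (7 * k) + 4 * (suc m * suc m) + d′ * c + 6 * k + 1
      ≡⟨ cong (λ s → s + d′ * c + 6 * k + 1) (sym (sumUpTo-arithmetic (suc m) (7 * k) 4)) ⟩
    S + 4 * suc m + d′ * c + 6 * k + 1
      ≡⟨ solve 4 (λ S T k n → S :+ con 4 :* n :+ T :+ con 6 :* k :+ con 1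
          := S :+ T :+ con 6 :* k :+ con 1 :+ con 4 :* n) refl S (d′ * c) k (suc m) ⟩
    S + d′ * c + 6 * k + 1 + 4 * suc m ∎)
    where
    open Data.Nat.Properties.≤-Reasoning
    d′ = suc m + e
    k = suc (m + d′)
    c = 10 * k + 8 * m
    S = sumUpTo (suc m) (λ x → 7 * k + 8 * x)
    slack = 6 * m * m + 12 * m + 5 * e * m + 3 * e + 7

  half-below : ∀ {K} a r {x} → K ≡ a + (a + r) → x < a → 2 * x + 1 ≤ K
  half-below a r {x} refl x<a = begin
    2 * x + 1   ≡⟨ solve 1 (λ x → con 2 :* x :+ con 1 := x :+ (con 1 :+ x)) refl x ⟩
    x + suc x   ≤⟨ +-mono-≤ (≤-trans (n≤1+n x) x<a) (≤-trans x<a (m≤m+n a r)) ⟩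
    a + (a + r) ∎
    where open Data.Nat.Properties.≤-Reasoning

  half-above : ∀ {K} a r {x} → K ≡ a + (a + r) → r ≤ 1 → a ≤ x → K ≤ 2 * x + 1
  half-above a r {x} refl r≤1 a≤x = ≤-trans (+-mono-≤ a≤x (+-mono-≤ a≤x r≤1))
    (≤-reflexive (solve 1 (λ x → x :+ (x :+ con 1) := con 2 :* x :+ con 1) refl x))

  lopsided⇒m<d : ∀ {K} m d → K ≡ m + d → 7 * suc K < 8 * d → suc m ≤ d
  lopsided⇒m<d m d refl 7k<8d with suc m ≤? d
  ... | yes m<d = m<d
  ... | no  m≮d = contradiction 7k<8d (≤⇒≯ (begin
    8 * d
      ≡⟨ solve 1 (λ d → con 8 :* d := d :+ con 7 :* d) refl d ⟩
    d + 7 * d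
      ≤⟨ +-monoˡ-≤ (7 * d) (≤-pred (≰⇒> m≮d)) ⟩
    m + 7 * d
      ≤⟨ m≤m+n (m + 7 * d) (7 + 6 * m) ⟩
    m + 7 * d + (7 + 6 * m)
      ≡⟨ solve 2 (λ m d → m :+ con 7 :* d :+ (con 7 :+ con 6 :* m) := con 7 :* (con 1 :+ (m :+ d))) refl m d ⟩
    7 * suc (m + d) ∎))
    where open Data.Nat.Properties.≤-Reasoning

  lopsided-below : ∀ {K} m d {x} → K ≡ m + d → suc m ≤ d → x ≤ m → 2 * x + 1 ≤ K
  lopsided-below m d {x} refl m<d x≤m = begin
    2 * x + 1   ≡⟨ solve 1 (λ x → con 2 :* x :+ con 1 := x :+ (con 1 :+ x)) refl x ⟩
    x + suc x   ≤⟨ +-mono-≤ x≤m (≤-trans (s≤s x≤m) m<d) ⟩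
    m + d       ∎
    where open Data.Nat.Properties.≤-Reasoning

module Labelling {k : ℕ} (q : Fin k → Fin k → Fin k) where

  open import Data.Nat using (_+_; _≤_)
  open import Data.Nat.Properties using (+-0-commutativeMonoid)
  open import Data.Fin using (_≟_)
  open import Data.Product using (_,_)
  open import Relation.Nullary.Decidable using (⌊_⌋; fromWitness)
  open import Relation.Binary.PropositionalEquality
  open import Algebra.Properties.CommutativeMonoid.Sum +-0-commutativeMonoid
    using (sum-syntax; sum-cong-≗; ∑-comm; ∑-distrib-+)
  open Counting
  open Weights

  rowCount : Fin k → Fin k → ℕ
  rowCount i ℓ = countFin k (λ b → ⌊ q i b ≟ ℓ ⌋)

  weight : Fin k → Fin k → ℕ
  weight i ℓ = φ₈ k ⌊ i ≟ ℓ ⌋ (rowCount i ℓ)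

  rowWeight : Fin k → ℕ
  rowWeight i = ∑[ ℓ < k ] weight i ℓ

  totalWeight : ℕ
  totalWeight = ∑[ i < k ] rowWeight i

  rowCount-≥1 : ∀ {i j ℓ} → q i j ≡ ℓ → 1 ≤ rowCount i ℓ
  rowCount-≥1 {i} {j} {ℓ} qij≡ℓ = countFin-≥1 k j (fromWitness {a? = q i j ≟ ℓ} qij≡ℓ)

  g₈-Row∩Part : (∀ ℓ → q ℓ ℓ ≡ ℓ) → ∀ i ℓ → g₈ (Row i ∩ Part q ℓ) ≡ weight i ℓ
  g₈-Row∩Part diagonal i ℓ =
    cong₂ (φ₈ k) (trans (hasDiag-Row∩ i (Part q ℓ)) (cong (λ c → ⌊ c ≟ ℓ ⌋) (diagonal i))) (card-Row∩ i (Part q ℓ))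

  g₈-Col∩Part : SymmetricMultiway q → ∀ i ℓ → g₈ (Col i ∩ Part q ℓ) ≡ weight i ℓ
  g₈-Col∩Part (symmetric , diagonal) i ℓ =
    cong₂ (φ₈ k) (trans (hasDiag-Col∩ i (Part q ℓ)) (cong (λ c → ⌊ c ≟ ℓ ⌋) (diagonal i)))
                 (trans (card-Col∩ i (Part q ℓ)) (countFin-cong k (λ a → cong (λ c → ⌊ c ≟ ℓ ⌋) (symmetric a i))))

  ∑f₈-Part≡twice-totalWeight : SymmetricMultiway q → ∑[ ℓ < k ] f₈ (Part q ℓ) ≡ totalWeight + totalWeight
  ∑f₈-Part≡twice-totalWeight q-sym@(_ , diagonal) = begin
    ∑[ ℓ < k ] ∑[ i < k ] (g₈ (Row i ∩ Part q ℓ) + g₈ (Col i ∩ Part q ℓ))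
      ≡⟨ sum-cong-≗ {k} (λ ℓ → sum-cong-≗ {k} (λ i → cong₂ _+_ (g₈-Row∩Part diagonal i ℓ) (g₈-Col∩Part q-sym i ℓ))) ⟩
    ∑[ ℓ < k ] ∑[ i < k ] (weight i ℓ + weight i ℓ)
      ≡⟨ ∑-comm (λ ℓ i → weight i ℓ + weight i ℓ) ⟩
    ∑[ i < k ] ∑[ ℓ < k ] (weight i ℓ + weight i ℓ)
      ≡⟨ sum-cong-≗ {k} (λ i → ∑-distrib-+ (weight i) (weight i)) ⟩
    ∑[ i < k ] (rowWeight i + rowWeight i)
      ≡⟨ ∑-distrib-+ rowWeight rowWeight ⟩
    totalWeight + totalWeight ∎
    where open ≡-Reasoning

module Staircase
  {K : ℕ} (q : Fin (suc K) → Fin (suc K) → Fin (suc K)) (symmetric : SymmetricMultiway q) (istar : Fin (suc K))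
  (low  : ∀ (i j : Fin (suc K)) → toℕ i Data.Nat.≤ toℕ istar → toℕ i Data.Nat.< toℕ j → q i j ≡ i)
  (high : ∀ (i j : Fin (suc K)) → toℕ istar Data.Nat.< toℕ i → toℕ i Data.Nat.< toℕ j → toℕ (q i j) ≡ 0)
  where

  open import Data.Bool using (T; true; false; if_then_else_)
  open import Data.Nat using (zero; _+_; _*_; _∸_; _≤_; _<_; _≤?_; _≤ᵇ_; _<ᵇ_; z≤n; s≤s)
  open import Data.Nat.Properties
    using (≤-trans; ≤-reflexive; <⇒≤; <-≤-trans; ≤-pred; <-irrefl; n≤1+n; m≤m+n; +-mono-≤; +-monoˡ-≤;
           m⊓n≤n; m≤n⇒m⊓n≡m; m≥n⇒m⊓n≡n; m+[n∸m]≡n; m≤n⇒m<n∨m≡n; ≤ᵇ⇒≤; <ᵇ⇒<; ≰⇒>; ≤-<-connex)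
  open import Data.Nat.Solver using (module +-*-Solver)
  open import Data.Fin using (zero; suc; _≟_)
  open import Data.Fin.Properties using (toℕ-injective; toℕ<n; suc-injective; <-cmp)
  open import Data.Product using (_,_; proj₁; proj₂)
  open import Data.Sum using (inj₁; inj₂)
  open import Data.Empty using (⊥-elim)
  open import Data.Unit using (tt)
  open import Relation.Nullary using (yes; no)
  open import Relation.Nullary.Decidable using (⌊_⌋; fromWitness)
  open import Relation.Binary.Definitions using (tri<; tri≈; tri>)
  open import Relation.Binary.PropositionalEquality
  open import Algebra.Properties.CommutativeMonoid.Sum Data.Nat.Properties.+-0-commutativeMonoid using (sum-syntax)
  open +-*-Solver using (solve; _:+_; _:*_; _:=_; con)
  open Sums
  open Counting
  open Weights
  open RowArithmetic
  open Labelling q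

  k m d : ℕ
  k = suc K
  m = toℕ istar
  d = K ∸ m

  m≤K : m ≤ K
  m≤K = ≤-pred (toℕ<n istar)

  K≡m+d : K ≡ m + d
  K≡m+d = sym (m+[n∸m]≡n m≤K)

  q-row : ∀ {i j} → toℕ i ≤ m → toℕ i ≤ toℕ j → q i j ≡ i
  q-row {i} {j} i≤m i≤j with m≤n⇒m<n∨m≡n i≤j
  ... | inj₁ i<j = low i j i≤m i<j
  ... | inj₂ i≡j with toℕ-injective {i = i} {j} i≡j
  ...   | refl = proj₂ symmetric i

  q-col : ∀ {i j} → toℕ j ≤ m → toℕ j ≤ toℕ i → q i j ≡ j
  q-col {i} {j} j≤m j≤i = trans (proj₁ symmetric i j) (q-row j≤m j≤i)

  q-high : ∀ {i j} → m < toℕ i → m < toℕ j → i ≢ j → q i j ≡ zero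
  q-high {i} {j} m<i m<j i≢j with <-cmp i j
  ... | tri< i<j _   _   = toℕ-injective (high i j m<i i<j)
  ... | tri≈ _   i≡j _   = ⊥-elim (i≢j i≡j)
  ... | tri> _   _   j<i = trans (proj₁ symmetric i j) (toℕ-injective (high j i m<j j<i))

  rowCount-diagonal : ∀ {i} → toℕ i ≤ m → k ∸ toℕ i ≤ rowCount i i
  rowCount-diagonal {i} i≤m = subst (_≤ rowCount i i) (countFin-suffix k (toℕ i))
    (countFin-mono k (λ b i≤b → fromWitness {a? = q i b ≟ i} (q-row i≤m (≤ᵇ⇒≤ (toℕ i) (toℕ b) i≤b))))

  rowCount-zero : ∀ {i} → m < toℕ i → d ≤ rowCount i zero
  rowCount-zero {suc i} m<i = begin
    d                                                       ≡⟨ sym (countFin-suffix K m) ⟩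
    countFin K (λ b → m ≤ᵇ toℕ b)                           ≤⟨ countFin-mono-except K i zero-beyond-m ⟩
    suc (countFin K (λ b → ⌊ q (suc i) (suc b) ≟ zero ⌋))   ≤⟨ +-monoˡ-≤ _ zero-at-zero ⟩
    rowCount (suc i) zero                                   ∎
    where
    open Data.Nat.Properties.≤-Reasoning
    zero-at-zero : 1 ≤ ind ⌊ q (suc i) zero ≟ zero ⌋
    zero-at-zero = ind-mono {true} (λ _ → fromWitness {a? = q (suc i) zero ≟ zero} (q-col z≤n z≤n))
    zero-beyond-m : ∀ b → b ≢ i → T (m ≤ᵇ toℕ b) → T ⌊ q (suc i) (suc b) ≟ zero ⌋
    zero-beyond-m b b≢i m≤b = fromWitness {a? = q (suc i) (suc b) ≟ zero}
      (q-high m<i (s≤s (≤ᵇ⇒≤ m (toℕ b) m≤b)) (λ i≡b → b≢i (sym (suc-injective i≡b))))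

  low-row : 8 ≤ 3 * k → ∀ {i} → toℕ i ≤ m → 8 * toℕ i + φt₈ k (k ∸ toℕ i) ≤ rowWeight i
  low-row 8≤3k {i} i≤m = begin
    8 * x + c
      ≤⟨ +-mono-≤ (≤-reflexive (cong (8 *_) (sym below))) diagonal ⟩
    8 * countFin k (λ ℓ → toℕ ℓ <ᵇ x) + c * countFin k (λ ℓ → ⌊ i ≟ ℓ ⌋)
      ≡⟨ sym (∑-if₂ k (λ ℓ → toℕ ℓ <ᵇ x) (λ ℓ → ⌊ i ≟ ℓ ⌋) 8 c) ⟩
    ∑[ ℓ < k ] ((if toℕ ℓ <ᵇ x then 8 else 0) + (if ⌊ i ≟ ℓ ⌋ then c else 0))
      ≤⟨ ∑-mono-≤ cell ⟩
    rowWeight i ∎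
    where
    open Data.Nat.Properties.≤-Reasoning
    x = toℕ i
    c = φt₈ k (k ∸ x)
    below : countFin k (λ ℓ → toℕ ℓ <ᵇ x) ≡ x
    below = countFin-prefix k x (<⇒≤ (toℕ<n i))
    diagonal : c ≤ c * countFin k (λ ℓ → ⌊ i ≟ ℓ ⌋)
    diagonal = c≤c*countFin k c {λ ℓ → ⌊ i ≟ ℓ ⌋} i (fromWitness {a? = i ≟ i} refl)
    cell : ∀ ℓ → (if toℕ ℓ <ᵇ x then 8 else 0) + (if ⌊ i ≟ ℓ ⌋ then c else 0) ≤ φ₈ k ⌊ i ≟ ℓ ⌋ (rowCount i ℓ)
    cell ℓ with i ≟ ℓ | toℕ ℓ <ᵇ x | <ᵇ⇒< (toℕ ℓ) x
    ... | yes refl | true  | ℓ<i = ⊥-elim (<-irrefl refl (ℓ<i tt))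
    ... | yes refl | false | _   = φt₈-mono k (rowCount-diagonal i≤m)
    ... | no  _    | true  | ℓ<i = φn₈-≥-8 {k} 8≤3k (rowCount-≥1 (q-col (≤-trans (<⇒≤ (ℓ<i tt)) i≤m) (<⇒≤ (ℓ<i tt))))
    ... | no  _    | false | _   = z≤n

  high-row : 8 ≤ 3 * k → ∀ {i} → m < toℕ i → φn₈ k d + (8 * m + 3 * k) ≤ rowWeight i
  high-row 8≤3k {suc i} m<i = +-mono-≤ (φn₈-mono k (rowCount-zero m<i)) (begin
    8 * m + 3 * k
      ≤⟨ +-mono-≤ (≤-reflexive (cong (8 *_) (sym below))) diagonal ⟩
    8 * countFin K (λ ℓ → toℕ ℓ <ᵇ m) + 3 * k * countFin K (λ ℓ → ⌊ suc i ≟ suc ℓ ⌋)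
      ≡⟨ sym (∑-if₂ K (λ ℓ → toℕ ℓ <ᵇ m) (λ ℓ → ⌊ suc i ≟ suc ℓ ⌋) 8 (3 * k)) ⟩
    ∑[ ℓ < K ] ((if toℕ ℓ <ᵇ m then 8 else 0) + (if ⌊ suc i ≟ suc ℓ ⌋ then 3 * k else 0))
      ≤⟨ ∑-mono-≤ cell ⟩
    ∑[ ℓ < K ] weight (suc i) (suc ℓ) ∎)
    where
    open Data.Nat.Properties.≤-Reasoning
    below : countFin K (λ ℓ → toℕ ℓ <ᵇ m) ≡ m
    below = countFin-prefix K m m≤K
    ℓ<m⇒ℓ<i : ∀ {ℓ} → m < suc (toℕ i) → toℕ ℓ < m → toℕ ℓ < toℕ i
    ℓ<m⇒ℓ<i m<i ℓ<m = <-≤-trans ℓ<m (≤-pred m<i)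
    diagonal : 3 * k ≤ 3 * k * countFin K (λ ℓ → ⌊ suc i ≟ suc ℓ ⌋)
    diagonal = c≤c*countFin K (3 * k) {λ ℓ → ⌊ suc i ≟ suc ℓ ⌋} i (fromWitness {a? = suc i ≟ suc i} refl)
    cell : ∀ ℓ → (if toℕ ℓ <ᵇ m then 8 else 0) + (if ⌊ suc i ≟ suc ℓ ⌋ then 3 * k else 0)
                 ≤ φ₈ k ⌊ suc i ≟ suc ℓ ⌋ (rowCount (suc i) (suc ℓ))
    cell ℓ with suc i ≟ suc ℓ | toℕ ℓ <ᵇ m | <ᵇ⇒< (toℕ ℓ) m
    ... | yes refl | true  | ℓ<m = ⊥-elim (<-irrefl refl (ℓ<m⇒ℓ<i m<i (ℓ<m tt)))
    ... | yes refl | false | _   = φt₈-≥-3k {k} (rowCount-≥1 (proj₂ symmetric (suc i)))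
    ... | no  _    | true  | ℓ<m = φn₈-≥-8 {k} 8≤3k (rowCount-≥1 (q-col (ℓ<m tt) (s≤s (<⇒≤ (ℓ<m⇒ℓ<i m<i (ℓ<m tt))))))
    ... | no  _    | false | _   = z≤n

  rowBound≤rowWeight : 8 ≤ 3 * k → 8 * d ≤ 7 * k → ∀ i → rowBound K (toℕ i) ≤ rowWeight i
  rowBound≤rowWeight 8≤3k 8d≤7k i with toℕ i ≤? m
  ... | yes i≤m = ≤-trans (rowBound-≤ 8≤3k (≤-trans i≤m m≤K)) (low-row 8≤3k i≤m)
  ... | no  i≰m = ≤-trans (m⊓n≤n _ _) (≤-trans (≤-reflexive high≡) (high-row 8≤3k (≰⇒> i≰m)))
    where
    open ≡-Reasoning
    high≡ : 3 * k + 8 * K ≡ φn₈ k d + (8 * m + 3 * k)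
    high≡ = begin
      3 * k + 8 * K              ≡⟨ cong (λ t → 3 * k + 8 * t) K≡m+d ⟩
      3 * k + 8 * (m + d)        ≡⟨ solve 3 (λ k m d → con 3 :* k :+ con 8 :* (m :+ d)
                                                      := con 8 :* d :+ (con 8 :* m :+ con 3 :* k)) refl k m d ⟩
      8 * d + (8 * m + 3 * k)    ≡⟨ cong (_+ (8 * m + 3 * k)) (sym (m≤n⇒m⊓n≡m 8d≤7k)) ⟩
      φn₈ k d + (8 * m + 3 * k)  ∎

  totalWeight-balanced : 8 ≤ 3 * k → 8 * d ≤ 7 * k → 10 * k * k ≤ totalWeight + 6 * k + 1
  totalWeight-balanced 8≤3k 8d≤7k with half K
  ... | a , r , r≤1 , K≡a+a+r = ≤-trans (balanced-sum-bound a r K≡a+a+r) (+-monoˡ-≤ 1 (+-monoˡ-≤ (6 * k)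
          (∑-≥-split a (λ x → 7 * k + 8 * x) (3 * k + 8 * K) a≤k below above)))
    where
    a≤k : a ≤ k
    a≤k = ≤-trans (m≤m+n a (a + r)) (≤-trans (≤-reflexive (sym K≡a+a+r)) (n≤1+n K))
    below : ∀ i → toℕ i < a → 7 * k + 8 * toℕ i ≤ rowWeight i
    below i x<a = ≤-trans (rowBound-small (toℕ i) (half-below a r K≡a+a+r x<a)) (rowBound≤rowWeight 8≤3k 8d≤7k i)
    above : ∀ i → a ≤ toℕ i → 3 * k + 8 * K ≤ rowWeight i
    above i a≤x = ≤-trans (rowBound-large (toℕ i) (half-above a r K≡a+a+r r≤1 a≤x)) (rowBound≤rowWeight 8≤3k 8d≤7k i)

  totalWeight-lopsided : 8 ≤ 3 * k → 7 * k < 8 * d → 10 * k * k ≤ totalWeight + 6 * k + 1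
  totalWeight-lopsided 8≤3k 7k<8d = ≤-trans (lopsided-sum-bound m d K≡m+d m<d) (+-monoˡ-≤ 1 (+-monoˡ-≤ (6 * k)
          (∑-≥-split (suc m) (λ x → 7 * k + 8 * x) (10 * k + 8 * m) (s≤s m≤K) below above)))
    where
    m<d : suc m ≤ d
    m<d = lopsided⇒m<d m d K≡m+d 7k<8d
    below : ∀ i → toℕ i < suc m → 7 * k + 8 * toℕ i ≤ rowWeight i
    below i (s≤s i≤m) = ≤-trans (rowBound-small (toℕ i) (lopsided-below m d K≡m+d m<d i≤m))
                          (≤-trans (rowBound-≤ 8≤3k (≤-trans i≤m m≤K)) (low-row 8≤3k i≤m))
    above : ∀ i → suc m ≤ toℕ i → 10 * k + 8 * m ≤ rowWeight i
    above i m<i = ≤-trans (≤-reflexive high≡) (high-row 8≤3k m<i)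
      where
      open ≡-Reasoning
      high≡ : 10 * k + 8 * m ≡ φn₈ k d + (8 * m + 3 * k)
      high≡ = begin
        10 * k + 8 * m
          ≡⟨ solve 2 (λ k m → con 10 :* k :+ con 8 :* m := con 7 :* k :+ (con 8 :* m :+ con 3 :* k)) refl k m ⟩
        7 * k + (8 * m + 3 * k)
          ≡⟨ cong (_+ (8 * m + 3 * k)) (sym (m≥n⇒m⊓n≡n (<⇒≤ 7k<8d))) ⟩
        φn₈ k d + (8 * m + 3 * k) ∎

  totalWeight-bound : 8 ≤ 3 * k → 10 * k * k ≤ totalWeight + 6 * k + 1
  totalWeight-bound 8≤3k with ≤-<-connex (8 * d) (7 * k)
  ... | inj₁ 8d≤7k = totalWeight-balanced 8≤3k 8d≤7k
  ... | inj₂ 7k<8d = totalWeight-lopsided 8≤3k 7k<8d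

open import Data.Nat using (ℕ; _≤_; s≤s)
open import Data.Fin using (Fin; toℕ; _<_)
open import Data.Integer using (+_)
open import Data.Rational using (_/_; _*_; _-_)
open import Relation.Binary.PropositionalEquality using (_≡_; cong; sym)
import Data.Nat as ℕ
import Data.Nat.Properties as ℕP
import Data.Rational.Properties as ℚP
open import Algebra.Properties.CommutativeMonoid.Sum ℕP.+-0-commutativeMonoid using (sum-syntax)
open Weights using (f₈)
open Scaling using (⅛; target-≤; ∑-≤-sumFin; f₈-≤-f)

lemma2p10 : (k : ℕ) → 4 ≤ k → (q : Fin k → Fin k → Fin k) → SymmetricMultiway q
    → (istar : Fin k)
    → (∀ (i j : Fin k) → toℕ i ≤ toℕ istar → i < j → q i j ≡ i)
    → (∀ (i j : Fin k) → toℕ istar Data.Nat.< toℕ i → i < j → toℕ (q i j) ≡ 0)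
    → Data.Rational._≤_ ((ℕ→ℚ (10 Data.Nat.* k Data.Nat.* k) - ℕ→ℚ (6 Data.Nat.* k) - ℕ→ℚ 1) * (+ 1 / 4))
        (sumFin k (λ ℓ → f (Part q ℓ)))
lemma2p10 (ℕ.suc K) (s≤s 3≤K) q symmetric istar low high = begin
  (ℕ→ℚ (10 ℕ.* k ℕ.* k) - ℕ→ℚ (6 ℕ.* k) - ℕ→ℚ 1) * (+ 1 / 4)
    ≤⟨ target-≤ k totalWeight (totalWeight-bound 8≤3k) ⟩
  ℕ→ℚ (totalWeight ℕ.+ totalWeight) * ⅛
    ≡⟨ cong (λ n → ℕ→ℚ n * ⅛) (sym (∑f₈-Part≡twice-totalWeight symmetric)) ⟩
  ℕ→ℚ (∑[ ℓ < k ] f₈ (Part q ℓ)) * ⅛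
    ≤⟨ ∑-≤-sumFin k {λ ℓ → f₈ (Part q ℓ)} {λ ℓ → f (Part q ℓ)} (λ ℓ → f₈-≤-f 8≤3k (Part q ℓ)) ⟩
  sumFin k (λ ℓ → f (Part q ℓ))
    ∎
  where
  open ℚP.≤-Reasoning
  open Staircase q symmetric istar low high using (k; totalWeight-bound)
  open Labelling q using (totalWeight; ∑f₈-Part≡twice-totalWeight)
  8≤3k : 8 ≤ 3 ℕ.* k
  8≤3k = ℕP.≤-trans (ℕP.m≤m+n 8 4) (ℕP.*-monoʳ-≤ 3 (s≤s 3≤K))
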